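{- Let $a_1a_2a_3\dots$ and $b_1b_2b_3\dots$ be infinite sequences of positive integers. Let $A_k$ be the insertion tableau of $a_1\dots a_k$ and $B_k$ that of $b_1\dots b_k$. Suppose there is $M$ such that $A_M=B_M$, $a_k=b_k$ for all $k>M$, and $A_k$ and $B_k$ are row-strict for all $k\le M$. Then $a_1a_2a_3\dots$ is equivalent to $b_1b_2b_3\dots$.
   Context: Insertion tableau means the RSK (row-insertion) tableau of a finite word. A tableau is row-strict if its entries strictly increase along each row. Strict Knuth transformations on a sequence $a_1a_2\dots$ of integers: $\kappa_k$ replaces $a_ka_{k+1}a_{k+2}$ by $a_ka_{k+2}a_{k+1}$ if $a_{k+1}<a_k<a_{k+2}$ or $a_{k+2}<a_k<a_{k+1}$, by $a_{k+1}a_ka_{k+2}$ if $a_k<a_{k+2}<a_{k+1}$ or $a_{k+1}<a_{k+2}<a_k$, and is undefined otherwise (other terms unchanged). Two infinite sequences $a,b$ are equivalent if for every $N\ge0$ there are strict Knuth transformations $\kappa_{k_1},\dots,\kappa_{k_r}$ (all defined) such that the first $N$ terms of $\kappa_{k_1}\circ\dots\circ\kappa_{k_r}(a)$ equal the first $N$ terms of $b$. -}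

module Defs where

open import Data.Nat using (ℕ; zero; suc; _<_; _<ᵇ_)
open import Data.Bool using (true; false)
open import Data.Sum using (_⊎_)
open import Data.Maybe using (Maybe; just; nothing)
open import Data.Product using (_×_; _,_; ∃)
open import Data.List using (List; []; _∷_; [_]; foldl; map; upTo)
open import Data.List.Relation.Unary.All using (All)
open import Data.List.Relation.Unary.Linked using (Linked)
open import Relation.Binary.Construct.Closure.ReflexiveTransitive using (Star)
open import Relation.Binary.PropositionalEquality using (_≡_)

-- Infinite sequences a₁a₂a₃…, 0-indexed: (s i) is the term a_{i+1}.
Seq : Set
Seq = ℕ → ℕ

-- A tableau is a list of rows (top row first).
Tableau : Set
Tableau = List (List ℕ)

rowInsert : ℕ → List ℕ → Maybe ℕ × List ℕ
rowInsert x [] = nothing , [ x ]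
rowInsert x (y ∷ ys) with x <ᵇ y
... | true = just y , x ∷ ys
... | false with rowInsert x ys
...   | m , ys' = m , y ∷ ys'

insertT : ℕ → Tableau → Tableau
insertT x [] = [ [ x ] ] 
insertT x (r ∷ rs) with rowInsert x r
... | nothing , r' = r' ∷ rs
... | just y , r' = r' ∷ insertT y rs

P : List ℕ → Tableau
P w = foldl (λ t x → insertT x t) [] w

prefix : Seq → ℕ → List ℕ
prefix a k = map a (upTo k)

RowStrict : Tableau → Set
RowStrict T = All (Linked _<_) T

-- κ_k (positions k, k+1, k+2 in 0-indexed form): Kappa k a b means that
-- κ_k is defined on a and κ_k(a) = b.
data Kappa (k : ℕ) (a b : Seq) : Set where
  swap23 : (a (suc k) < a k × a k < a (suc (suc k)))
           ⊎ (a (suc (suc k)) < a k × a k < a (suc k)) →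
           b k ≡ a k → b (suc k) ≡ a (suc (suc k)) → b (suc (suc k)) ≡ a (suc k) →
           (∀ i → i < k ⊎ suc (suc k) < i → b i ≡ a i) →
           Kappa k a b
  swap12 : (a k < a (suc (suc k)) × a (suc (suc k)) < a (suc k))
           ⊎ (a (suc k) < a (suc (suc k)) × a (suc (suc k)) < a k) →
           b k ≡ a (suc k) → b (suc k) ≡ a k → b (suc (suc k)) ≡ a (suc (suc k)) →
           (∀ i → i < k ⊎ suc (suc k) < i → b i ≡ a i) →
           Kappa k a b

KnuthStep : Seq → Seq → Set
KnuthStep a b = ∃ λ k → Kappa k a b

Equivalent : Seq → Seq → Set
Equivalent a b = ∀ N → ∃ λ c → Star KnuthStep a c × (∀ i → i < N → c i ≡ b i)

-- Read a tableau row by row from the bottom row to the top row.  If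
-- the tableaux before and after inserting x are row-strict, the word
-- (reading word of T) x is connected to the reading word of (insertT x T) by
-- strict Knuth moves: in each row the inserted letter slides left past the
-- larger entries (a κ-move of type "swap23") and the bumped letter slides
-- left past the smaller ones (type "swap12").  Inserting letter by letter,
-- every prefix a₁…a_M is connected to the reading word of its tableau; as
-- A_M = B_M the two prefixes are connected to each other.  Finally a chain of
-- moves on the finite prefixes lifts to κ-moves on the whole sequences with
-- the common tail attached, which ends in a sequence agreeing with b
-- everywhere — in particular on the first N terms for every N.
module Submission where

open import Defs
open import Data.Nat using (ℕ; _<_; _≤_; _≥_)
open import Relation.Binary.PropositionalEquality using (_≡_)

open import Data.Nat using (zero; suc; _+_; _<ᵇ_; s≤s)
open import Data.Nat.Properties using (<-trans; <ᵇ⇒<; m≤m+n; ≤-refl; ≤-trans; n≤1+n)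
open import Data.Bool using (true; false)
open import Data.Unit using (tt)
open import Data.Maybe using (Maybe; just; nothing)
open import Data.Sum using (_⊎_; inj₁; inj₂) renaming (swap to ⊎-swap; map to ⊎-map)
open import Data.Product using (_×_; _,_; ∃) renaming (map to ×-map)
open import Data.List using (List; []; _∷_; [_]; _++_; map; applyUpTo)
open import Data.List.Properties using (++-assoc; map-++; foldl-++; applyUpTo-∷ʳ)
open import Data.List.Relation.Unary.All using (All; _∷_)
open import Data.List.Relation.Unary.AllPairs using (_∷_)
open import Data.List.Relation.Unary.Linked using (Linked; [-]; _∷_; tail)
open import Data.List.Relation.Unary.Linked.Properties using (Linked⇒AllPairs)
open import Relation.Binary.Construct.Closure.ReflexiveTransitive
  using (Star; ε; _◅_; _◅◅_; gmap; reverse)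
open import Relation.Binary.Construct.Closure.ReflexiveTransitive.Properties
  using (reflexive; module StarReasoning)
open import Relation.Binary.PropositionalEquality
  using (refl; sym; trans; cong; subst; subst₂)

-- One strict Knuth move somewhere inside a finite word; the conditions are
-- those of κ_k in the paper, 'there' shifts the position by one.
data _⇝_ : List ℕ → List ℕ → Set where
  swap23 : ∀ {x y z w} → (y < x × x < z) ⊎ (z < x × x < y) →
           (x ∷ y ∷ z ∷ w) ⇝ (x ∷ z ∷ y ∷ w)
  swap12 : ∀ {x y z w} → (x < z × z < y) ⊎ (y < z × z < x) →
           (x ∷ y ∷ z ∷ w) ⇝ (y ∷ x ∷ z ∷ w)
  there  : ∀ {x w w'} → w ⇝ w' → (x ∷ w) ⇝ (x ∷ w')

_⇝*_ : List ℕ → List ℕ → Set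
_⇝*_ = Star _⇝_

⇝-sym : ∀ {w w'} → w ⇝ w' → w' ⇝ w
⇝-sym (swap23 c) = swap23 (⊎-swap c)
⇝-sym (swap12 c) = swap12 (⊎-swap c)
⇝-sym (there m)  = there (⇝-sym m)

⇝*-sym : ∀ {w w'} → w ⇝* w' → w' ⇝* w
⇝*-sym = reverse ⇝-sym

⇝-++ʳ : ∀ z {w w'} → w ⇝ w' → (w ++ z) ⇝ (w' ++ z)
⇝-++ʳ z (swap23 c) = swap23 c
⇝-++ʳ z (swap12 c) = swap12 c
⇝-++ʳ z (there m)  = there (⇝-++ʳ z m)

⇝*-++ʳ : ∀ z {w w'} → w ⇝* w' → (w ++ z) ⇝* (w' ++ z)
⇝*-++ʳ z = gmap (_++ z) (⇝-++ʳ z)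

⇝-++ˡ : ∀ p {w w'} → w ⇝ w' → (p ++ w) ⇝ (p ++ w')
⇝-++ˡ []      m = m
⇝-++ˡ (x ∷ p) m = there (⇝-++ˡ p m)

⇝*-++ˡ : ∀ p {w w'} → w ⇝* w' → (p ++ w) ⇝* (p ++ w')
⇝*-++ˡ p = gmap (p ++_) (⇝-++ˡ p)

data RowInsertion (x : ℕ) : List ℕ → Maybe ℕ → List ℕ → Set where
  append : RowInsertion x [] nothing [ x ]
  bump   : ∀ {y ys} → x < y → RowInsertion x (y ∷ ys) (just y) (x ∷ ys)
  pass   : ∀ {y ys m ys'} → RowInsertion x ys m ys' →
           RowInsertion x (y ∷ ys) m (y ∷ ys')

rowInsert-shape : ∀ x r → let (m , r') = rowInsert x r in RowInsertion x r m r'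
rowInsert-shape x []       = append
rowInsert-shape x (y ∷ ys) with x <ᵇ y | <ᵇ⇒< x y
... | true  | x<y = bump (x<y tt)
... | false | _ with rowInsert x ys | rowInsert-shape x ys
...   | _ , _ | shape = pass shape

no-bump-appends : ∀ {x r r'} → RowInsertion x r nothing r' → r' ≡ r ++ [ x ]
no-bump-appends append     = refl
no-bump-appends (pass ins) = cong (_ ∷_) (no-bump-appends ins)

bumped-All : ∀ {Q : ℕ → Set} {x r y r'} → RowInsertion x r (just y) r' → All Q r → Q y
bumped-All (bump _)   (qy ∷ _)  = qy
bumped-All (pass ins) (_ ∷ qys) = bumped-All ins qys

above-head : ∀ {z zs} → Linked _<_ (z ∷ zs) → All (z <_) zs
above-head l with Linked⇒AllPairs <-trans l
... | z<zs ∷ _ = z<zs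

-- After bumping y from a strictly increasing row, the new row starts with an
-- entry smaller than y: either x itself, or the untouched first entry.
head-below-bumped : ∀ {x r y w ws} → RowInsertion x r (just y) (w ∷ ws) →
                    Linked _<_ r → w < y
head-below-bumped (bump x<y)  _ = x<y
head-below-bumped (pass ins) l = bumped-All ins (above-head l)

-- A letter x smaller than every entry of the increasing row z ∷ zs slides
-- left until it sits just after z, using swap23 with z as the witness.
slide-inserted : ∀ {x z zs} → x < z → Linked _<_ (z ∷ zs) →
                 (z ∷ zs ++ [ x ]) ⇝* (z ∷ x ∷ zs)
slide-inserted {zs = []}     _   _           = ε
slide-inserted {zs = v ∷ vs} x<z (z<v ∷ lv) =
  ⇝*-++ˡ [ _ ] (slide-inserted (<-trans x<z z<v) lv) ◅◅ (swap23 (inj₂ (x<z , z<v)) ◅ ε)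

row-lemma : ∀ {x r y r'} → RowInsertion x r (just y) r' →
            Linked _<_ r → Linked _<_ r' → (r ++ [ x ]) ⇝* (y ∷ r')
row-lemma (bump x<y) l _ = slide-inserted x<y l
row-lemma (pass ()) _ [-]
row-lemma (pass ins) l (z<w ∷ l') =
  ⇝*-++ˡ [ _ ] (row-lemma ins (tail l) l')
  ◅◅ (swap12 (inj₁ (z<w , head-below-bumped ins (tail l))) ◅ ε)

reading : Tableau → List ℕ
reading []       = []
reading (r ∷ rs) = reading rs ++ r

-- If x
-- is appended to the top row both words coincide; if it bumps y, the row
-- lemma turns r x into y r' and y is inserted into the remaining rows.
insertion-lemma : ∀ x T → RowStrict T → RowStrict (insertT x T) →
                  (reading T ++ [ x ]) ⇝* reading (insertT x T)
insertion-lemma x []       _          _ = ε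
insertion-lemma x (r ∷ rs) (lr ∷ lrs) rs' with rowInsert x r | rowInsert-shape x r
... | nothing , r' | ins = reflexive _⇝_
  (trans (++-assoc (reading rs) r [ x ]) (cong (reading rs ++_) (sym (no-bump-appends ins))))
... | just y , r' | ins with rs'
...   | lr' ∷ lrs' = begin
  (reading rs ++ r) ++ [ x ]       ≡⟨ ++-assoc (reading rs) r [ x ] ⟩
  reading rs ++ (r ++ [ x ])       ⟶*⟨ ⇝*-++ˡ (reading rs) (row-lemma ins lr lr') ⟩
  reading rs ++ (y ∷ r')           ≡⟨ ++-assoc (reading rs) [ y ] r' ⟨
  (reading rs ++ [ y ]) ++ r'      ⟶*⟨ ⇝*-++ʳ r' (insertion-lemma y rs lrs lrs') ⟩
  reading (insertT y rs) ++ r'     ∎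
  where open StarReasoning _⇝_

prefix-suc : ∀ (a : Seq) k → prefix a (suc k) ≡ prefix a k ++ [ a k ]
prefix-suc a k = begin
  map a (applyUpTo (λ i → i) (suc k))          ≡⟨ cong (map a) (applyUpTo-∷ʳ (λ i → i) k) ⟨
  map a (applyUpTo (λ i → i) k ++ [ k ])       ≡⟨ map-++ a (applyUpTo (λ i → i) k) [ k ] ⟩
  prefix a k ++ [ a k ]                        ∎
  where open Relation.Binary.PropositionalEquality.≡-Reasoning

P-snoc : ∀ w x → P (w ++ [ x ]) ≡ insertT x (P w)
P-snoc w x = foldl-++ (λ t y → insertT y t) [] w [ x ]

prefix⇝*reading : ∀ (a : Seq) k → (∀ j → j ≤ k → RowStrict (P (prefix a j))) →
                  prefix a k ⇝* reading (P (prefix a k))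
prefix⇝*reading a zero    _  = ε
prefix⇝*reading a (suc k) rs = begin
  prefix a (suc k)                         ≡⟨ prefix-suc a k ⟩
  prefix a k ++ [ a k ]                    ⟶*⟨ ⇝*-++ʳ [ a k ] (prefix⇝*reading a k rs-below) ⟩
  reading (P (prefix a k)) ++ [ a k ]      ⟶*⟨ insertion-lemma (a k) _ (rs k (n≤1+n k)) rs-new ⟩
  reading (insertT (a k) (P (prefix a k))) ≡⟨ cong reading P-step ⟨
  reading (P (prefix a (suc k)))           ∎
  where
  open StarReasoning _⇝_

  P-step : P (prefix a (suc k)) ≡ insertT (a k) (P (prefix a k))
  P-step = trans (cong P (prefix-suc a k)) (P-snoc (prefix a k) (a k))

  rs-below : ∀ j → j ≤ k → RowStrict (P (prefix a j))
  rs-below j j≤k = rs j (≤-trans j≤k (n≤1+n k))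

  rs-new : RowStrict (insertT (a k) (P (prefix a k)))
  rs-new = subst RowStrict P-step (rs (suc k) ≤-refl)

_≐_ : Seq → Seq → Set
a ≐ b = ∀ i → a i ≡ b i

_∷ˢ_ : ℕ → Seq → Seq
(x ∷ˢ s) zero    = x
(x ∷ˢ s) (suc i) = s i

_++ˢ_ : List ℕ → Seq → Seq
[]      ++ˢ s = s
(x ∷ w) ++ˢ s = x ∷ˢ (w ++ˢ s)

++ˢ-congʳ : ∀ w {s s' : Seq} → s ≐ s' → (w ++ˢ s) ≐ (w ++ˢ s')
++ˢ-congʳ []      s≐s' i       = s≐s' i
++ˢ-congʳ (x ∷ w) s≐s' zero    = refl
++ˢ-congʳ (x ∷ w) s≐s' (suc i) = ++ˢ-congʳ w s≐s' i

drop : ℕ → Seq → Seq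
drop M a j = a (M + j)

-- A sequence is its prefix followed by the rest (proved for an arbitrary
-- reindexing g so that the induction goes through).
prefix-++-drop : ∀ (a : Seq) M → (prefix a M ++ˢ drop M a) ≐ a
prefix-++-drop a M = split (λ i → i) M
  where
  split : ∀ g M → (map a (applyUpTo g M) ++ˢ (λ j → a (g (M + j)))) ≐ (λ i → a (g i))
  split g zero    i       = refl
  split g (suc M) zero    = refl
  split g (suc M) (suc i) = split (λ n → g (suc n)) M i

outside-window₀ : ∀ {a b : Seq} → (∀ j → b (suc (suc (suc j))) ≡ a (suc (suc (suc j)))) →
                  ∀ i → i < 0 ⊎ 2 < i → b i ≡ a i
outside-window₀ agree (suc (suc (suc j))) _                      = agree j
outside-window₀ agree zero                (inj₂ ())
outside-window₀ agree (suc zero)          (inj₂ (s≤s ()))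
outside-window₀ agree (suc (suc zero))    (inj₂ (s≤s (s≤s ())))

outside-window-∷ : ∀ {k x} {a b : Seq} → (∀ i → i < k ⊎ suc (suc k) < i → b i ≡ a i) →
                   ∀ i → i < suc k ⊎ suc (suc (suc k)) < i → (x ∷ˢ b) i ≡ (x ∷ˢ a) i
outside-window-∷ agree zero    _                = refl
outside-window-∷ agree (suc i) (inj₁ (s≤s i<k)) = agree i (inj₁ i<k)
outside-window-∷ agree (suc i) (inj₂ (s≤s k<i)) = agree i (inj₂ k<i)

Kappa-∷ : ∀ {k a b} x → Kappa k a b → Kappa (suc k) (x ∷ˢ a) (x ∷ˢ b)
Kappa-∷ x (swap23 c p q r o) = swap23 c p q r (outside-window-∷ o)
Kappa-∷ x (swap12 c p q r o) = swap12 c p q r (outside-window-∷ o)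

module _ {a a' : Seq} (a≐a' : a ≐ a') where

  private
    <-resp : ∀ {i j} → a i < a j → a' i < a' j
    <-resp {i} {j} = subst₂ _<_ (a≐a' i) (a≐a' j)

    cond-resp : ∀ {i j k l m n p q} →
                (a i < a j × a k < a l) ⊎ (a m < a n × a p < a q) →
                (a' i < a' j × a' k < a' l) ⊎ (a' m < a' n × a' p < a' q)
    cond-resp = ⊎-map (×-map <-resp <-resp) (×-map <-resp <-resp)

  Kappa-respˡ : ∀ {k b} → Kappa k a b → Kappa k a' b
  Kappa-respˡ (swap23 c p q r o) =
    swap23 (cond-resp c) (trans p (a≐a' _)) (trans q (a≐a' _)) (trans r (a≐a' _))
      (λ i out → trans (o i out) (a≐a' i))
  Kappa-respˡ (swap12 c p q r o) =
    swap12 (cond-resp c) (trans p (a≐a' _)) (trans q (a≐a' _)) (trans r (a≐a' _))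
      (λ i out → trans (o i out) (a≐a' i))

⇝⇒KnuthStep : ∀ {w w'} (s : Seq) → w ⇝ w' → KnuthStep (w ++ˢ s) (w' ++ˢ s)
⇝⇒KnuthStep s (swap23 c) = 0 , swap23 c refl refl refl (outside-window₀ (λ _ → refl))
⇝⇒KnuthStep s (swap12 c) = 0 , swap12 c refl refl refl (outside-window₀ (λ _ → refl))
⇝⇒KnuthStep s (there {x = x} m) with ⇝⇒KnuthStep s m
... | k , κ = suc k , Kappa-∷ x κ

lift-chain : ∀ {w w'} (s a : Seq) → w ⇝* w' → a ≐ (w ++ˢ s) →
             ∃ λ c → Star KnuthStep a c × c ≐ (w' ++ˢ s)
lift-chain s a ε       a≐ = a , ε , a≐
lift-chain s a (m ◅ ms) a≐ with ⇝⇒KnuthStep s m | lift-chain s _ ms (λ _ → refl)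
... | k , κ | c , steps , c≐ =
  c , (k , Kappa-respˡ (λ i → sym (a≐ i)) κ) ◅ steps , c≐

prefix-moves⇒Equivalent : ∀ (a b : Seq) M → prefix a M ⇝* prefix b M →
                          (∀ i → i ≥ M → a i ≡ b i) → Equivalent a b
prefix-moves⇒Equivalent a b M moves same-tail N
  with lift-chain (drop M a) a moves (λ i → sym (prefix-++-drop a M i))
... | c , steps , c≐ = c , steps , λ i _ → begin
  c i                            ≡⟨ c≐ i ⟩
  (prefix b M ++ˢ drop M a) i    ≡⟨ ++ˢ-congʳ (prefix b M) tails-agree i ⟩
  (prefix b M ++ˢ drop M b) i    ≡⟨ prefix-++-drop b M i ⟩
  b i                            ∎
  where
  open Relation.Binary.PropositionalEquality.≡-Reasoning
  tails-agree : drop M a ≐ drop M b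
  tails-agree j = same-tail (M + j) (m≤m+n M j)

proposition2p6 : (a b : Seq) → (∀ i → 0 < a i) → (∀ i → 0 < b i) → (M : ℕ) →
    P (prefix a M) ≡ P (prefix b M) →
    (∀ i → i ≥ M → a i ≡ b i) →
    (∀ k → k ≤ M → RowStrict (P (prefix a k))) →
    (∀ k → k ≤ M → RowStrict (P (prefix b k))) →
    Equivalent a b
proposition2p6 a b _ _ M A≡B same-tail rsA rsB =
  prefix-moves⇒Equivalent a b M prefixes-connected same-tail
  where
  prefixes-connected : prefix a M ⇝* prefix b M
  prefixes-connected = begin
    prefix a M                 ⟶*⟨ prefix⇝*reading a M rsA ⟩
    reading (P (prefix a M))   ≡⟨ cong reading A≡B ⟩
    reading (P (prefix b M))   ⟶*⟨ ⇝*-sym (prefix⇝*reading b M rsB) ⟩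
    prefix b M                 ∎
    where open StarReasoning _⇝_
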